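{- Let $G$ be a pair of $d$-dimensional butterflies. Suppose that for every node $u$ on layer $\lfloor d/2\rfloor$ and every node $v$ on layer $2d-\lfloor d/2\rfloor$ of $G$ there is a directed path from $u$ to $v$. Let $A$ be a set of input nodes and $B$ a set of output nodes with $|A|=|B|\le 2^{\lfloor d/2\rfloor}$, and let $\rho:A\to B$ be any bijection. Then there exist node-disjoint paths from $A$ to $B$ such that, for every $a\in A$, the path starting at $a$ ends at $\rho(a)$.
   Context: The standard $d$-dimensional butterfly is the directed graph whose nodes are the pairs $(i,b)$ with $i\in\{0,\dots,d\}$ (the layer) and $b\in\{0,1\}^d$ (the label). For $1\le i\le d$ there is a directed edge from $(i-1,b)$ to each of the two nodes $(i,b')$ where $b'$ agrees with $b$ except possibly in coordinate $i$. Layer-$0$ nodes are inputs and layer-$d$ nodes are outputs. A pair of $d$-dimensional butterflies is formed from two directed graphs $G_1$ and $G_2$, each isomorphic to the standard $d$-dimensional butterfly (not necessarily identical to each other). The output nodes of $G_1$ are identified with the input nodes of $G_2$ via a bijection. The result has layers $0,\dots,2d$ (layer $j$ of $G_2$ becomes layer $d+j$); its inputs are the inputs of $G_1$ and its outputs are the outputs of $G_2$. "Node-disjoint paths from $A$ to $B$" means $|A|$ directed paths, each from a node of $A$ to a node of $B$, no two sharing a node and none repeating a node. Hence each node of $A\cup B$ is an endpoint of exactly one path. -}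

module Defs where

open import Data.Nat using (ℕ; zero; suc; _+_; _≤_)
open import Data.Fin using (Fin; toℕ)
open import Data.Vec using (Vec; lookup)
open import Data.Bool using (Bool)
open import Data.Product using (Σ; _×_; _,_; proj₁; proj₂)
open import Data.Sum using (_⊎_; inj₁; inj₂)
open import Data.Empty using (⊥)
open import Data.List using (List; []; _∷_)
open import Relation.Binary.PropositionalEquality using (_≡_; _≢_)
open import Function.Bundles using (_↔_; _⇔_; Inverse)

-- The standard d-dimensional butterfly.
-- Nodes (i , b): layer i ∈ {0..d}, label b ∈ {0,1}^d (a vector of d bits;
-- coordinate c ∈ {1..d} of the paper is index c-1 here).

Label : ℕ → Set
Label d = Vec Bool d

BNode : ℕ → Set
BNode d = Fin (suc d) × Label d

-- Edge (i-1 , b) → (i , b') for 1 ≤ i ≤ d, where b' agrees with b except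
-- possibly in coordinate i (i.e. at every index t with t+1 ≠ i).
BEdge : ∀ {d} → BNode d → BNode d → Set
BEdge {d} (i , b) (i' , b') =
  (toℕ i' ≡ suc (toℕ i)) ×
  ((t : Fin d) → suc (toℕ t) ≢ toℕ i' → lookup b t ≡ lookup b' t)

record ButterflyLike (d : ℕ) : Set₁ where
  field
    Node : Set
    Edge : Node → Node → Set
    iso  : Node ↔ BNode d
    edge-iso : ∀ x y → Edge x y ⇔ BEdge (Inverse.to iso x) (Inverse.to iso y)

  -- layer of a node (transported along the isomorphism; digraph
  -- isomorphisms of the butterfly preserve layers)
  layer : Node → ℕ
  layer x = toℕ (proj₁ (Inverse.to iso x))

  Inputs : Set
  Inputs = Σ Node (λ x → layer x ≡ 0)

  Outputs : Set
  Outputs = Σ Node (λ x → layer x ≡ d)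

record ButterflyPair (d : ℕ) : Set₁ where
  field
    G₁ G₂ : ButterflyLike d
    glue  : ButterflyLike.Outputs G₁ ↔ ButterflyLike.Inputs G₂

  module B₁ = ButterflyLike G₁
  module B₂ = ButterflyLike G₂

  -- Nodes of the glued graph: all nodes of G₁, plus the non-input nodes
  -- of G₂ (the inputs of G₂ are identified with the outputs of G₁).
  PNode : Set
  PNode = B₁.Node ⊎ Σ B₂.Node (λ w → 1 ≤ B₂.layer w)

  PEdge : PNode → PNode → Set
  PEdge (inj₁ x) (inj₁ y) = B₁.Edge x y
  PEdge (inj₁ x) (inj₂ (w , _)) =
    Σ (B₁.layer x ≡ d) (λ out → B₂.Edge (proj₁ (Inverse.to glue (x , out))) w)
  PEdge (inj₂ _) (inj₁ _) = ⊥
  PEdge (inj₂ (w , _)) (inj₂ (w' , _)) = B₂.Edge w w'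

  layer : PNode → ℕ
  layer (inj₁ x) = B₁.layer x
  layer (inj₂ (w , _)) = d + B₂.layer w

data Path {V : Set} (E : V → V → Set) : V → V → Set where
  [_]    : (x : V) → Path E x x
  _∷⟨_⟩_ : (x : V) {y z : V} → E x y → Path E y z → Path E x z

nodes : {V : Set} {E : V → V → Set} {x y : V} → Path E x y → List V
nodes [ x ] = x ∷ []
nodes (x ∷⟨ _ ⟩ p) = x ∷ nodes p

module Submission where

-- Request i is routed in three stages.  Read the input label of a i as a binary number Kᵢ
-- (first coordinate least significant) and let rᵢ < k ≤ 2 ^ m, where m = ⌊ d /2⌋, be the rank
-- of Kᵢ among all keys.
-- On layers 0..m of G₁ the path rewrites its first m coordinates to the binary digits of rᵢ,
-- then it follows the assumed path from layer m to layer 2d - m, and on the last m layers it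
-- performs the mirror image inside G₂, whose key is the output label read backwards.
-- A node on layer s ≥ m of G₁ shows all m digits of rᵢ, which determine i.  A node on layer
-- s < m shows the first s digits of rᵢ and the key digits from s on; two requests sharing it
-- would have ranks at least 2 ^ s apart but keys less than 2 ^ s apart, which is impossible
-- because distinct keys make rank differences at most key differences.  G₂ is symmetric.

open import Defs
open import Data.Bool using (Bool; true; false)
open import Data.Fin using (Fin; zero; suc; toℕ; fromℕ; fromℕ<; opposite)
import Data.Fin.Properties as Fin
open import Data.List.Relation.Binary.Disjoint.Propositional using (Disjoint)
open import Data.List.Relation.Unary.All as All using (All; []; _∷_)
open import Data.List.Relation.Unary.AllPairs using ([]; _∷_)
open import Data.List.Relation.Unary.Unique.Propositional using (Unique)
open import Data.Nat
open import Data.Nat.Properties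
open import Algebra.Properties.CommutativeSemigroup +-commutativeSemigroup
  using () renaming (interchange to +-interchange)
open import Data.Product using (Σ; _×_; _,_; proj₁; proj₂)
open import Data.Sum using (_⊎_; inj₁; inj₂; [_,_]′)
open import Data.Unit using (⊤; tt)
open import Data.Vec using (Vec; []; _∷_; lookup; tabulate)
open import Data.Vec.Properties using (lookup∘tabulate; tabulate∘lookup; tabulate-cong)
open import Function using (_∘_)
open import Function.Bundles using (Inverse; Equivalence)
open import Function.Definitions using (Injective)
open import Level using (0ℓ)
open import Relation.Binary using (tri<; tri≈; tri>)
open import Relation.Binary.PropositionalEquality
open import Relation.Nullary using (¬_; Dec; yes; no; does; contradiction)
open import Relation.Unary using (Pred; Decidable; _⊆_; _∪_)

Bits : Set
Bits = ℕ → Bool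

bitValue : Bool → ℕ
bitValue false = 0
bitValue true  = 1

bitValue≤1 : ∀ b → bitValue b ≤ 1
bitValue≤1 false = z≤n
bitValue≤1 true  = ≤-refl

-- Least significant digit first.
fromBits : ℕ → Bits → ℕ
fromBits zero    f = 0
fromBits (suc n) f = bitValue (f 0) + 2 * fromBits n (f ∘ suc)

fromBits-cong : ∀ n {f g} → (∀ u → u < n → f u ≡ g u) → fromBits n f ≡ fromBits n g
fromBits-cong zero    f≗g = refl
fromBits-cong (suc n) f≗g =
  cong₂ (λ b r → bitValue b + 2 * r) (f≗g 0 z<s) (fromBits-cong n (λ u u<n → f≗g (suc u) (s<s u<n)))

bitValue+2*-injective : ∀ a b x y → bitValue a + 2 * x ≡ bitValue b + 2 * y → a ≡ b × x ≡ y
bitValue+2*-injective false false x y eq = refl , *-cancelˡ-≡ x y 2 eq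
bitValue+2*-injective true  true  x y eq = refl , *-cancelˡ-≡ x y 2 (suc-injective eq)
bitValue+2*-injective false true  x y eq = contradiction eq (even≢odd x y)
bitValue+2*-injective true  false x y eq = contradiction (sym eq) (even≢odd y x)

fromBits-suc-injective : ∀ n {f g} → fromBits (suc n) f ≡ fromBits (suc n) g →
                         f 0 ≡ g 0 × fromBits n (f ∘ suc) ≡ fromBits n (g ∘ suc)
fromBits-suc-injective n {f} {g} =
  bitValue+2*-injective (f 0) (g 0) (fromBits n (f ∘ suc)) (fromBits n (g ∘ suc))

fromBits-injective : ∀ n {f g} → fromBits n f ≡ fromBits n g → ∀ u → u < n → f u ≡ g u
fromBits-injective (suc n) {f} {g} eq zero    _         = proj₁ (fromBits-suc-injective n {f} {g} eq)
fromBits-injective (suc n) {f} {g} eq (suc u) (s<s u<n) =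
  fromBits-injective n (proj₂ (fromBits-suc-injective n {f} {g} eq)) u u<n

fromBits-<-+2^ : ∀ n s {f g} → (∀ u → s ≤ u → u < n → f u ≡ g u) →
                 fromBits n g < fromBits n f + 2 ^ s
fromBits-<-+2^ n       zero    {f} {g} f≗g = begin-strict
  fromBits n g     ≡⟨ fromBits-cong n (λ u u<n → sym (f≗g u z≤n u<n)) ⟩
  fromBits n f     <⟨ m<m+n _ z<s ⟩
  fromBits n f + 1 ∎
  where open ≤-Reasoning
fromBits-<-+2^ zero    (suc s)         f≗g = m^n>0 2 (suc s)
fromBits-<-+2^ (suc n) (suc s) {f} {g} f≗g = begin-strict
  bitValue (g 0) + 2 * G               ≤⟨ +-monoˡ-≤ (2 * G) (bitValue≤1 (g 0)) ⟩
  1 + 2 * G                            <⟨ ≤-reflexive (sym (*-suc 2 G)) ⟩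
  2 * suc G                            ≤⟨ *-monoʳ-≤ 2 tail< ⟩
  2 * (F + 2 ^ s)                      ≤⟨ m≤n+m _ (bitValue (f 0)) ⟩
  bitValue (f 0) + 2 * (F + 2 ^ s)     ≡⟨ cong (bitValue (f 0) +_) (*-distribˡ-+ 2 F (2 ^ s)) ⟩
  bitValue (f 0) + (2 * F + 2 ^ suc s) ≡⟨ +-assoc (bitValue (f 0)) _ _ ⟨
  bitValue (f 0) + 2 * F + 2 ^ suc s   ∎
  where
  open ≤-Reasoning
  F G : ℕ
  F = fromBits n (f ∘ suc)
  G = fromBits n (g ∘ suc)
  tail< : G < F + 2 ^ s
  tail< = fromBits-<-+2^ n s (λ u s≤u u<n → f≗g (suc u) (s≤s s≤u) (s<s u<n))

fromBits-+2^-≤ : ∀ n s {f g} → (∀ u → u < s → f u ≡ g u) →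
                 fromBits n f < fromBits n g → fromBits n f + 2 ^ s ≤ fromBits n g
fromBits-+2^-≤ (suc n) zero    {f} {g} f≗g f<g = ≤-trans (≤-reflexive (+-comm _ 1)) f<g
fromBits-+2^-≤ (suc n) (suc s) {f} {g} f≗g f<g with f 0 | g 0 | f≗g 0 z<s
... | b | .b | refl = begin
  bitValue b + 2 * F + 2 ^ suc s   ≡⟨ +-assoc (bitValue b) _ _ ⟩
  bitValue b + (2 * F + 2 ^ suc s) ≡⟨ cong (bitValue b +_) (*-distribˡ-+ 2 F (2 ^ s)) ⟨
  bitValue b + 2 * (F + 2 ^ s)     ≤⟨ +-monoʳ-≤ (bitValue b) (*-monoʳ-≤ 2 tail≤) ⟩
  bitValue b + 2 * G               ∎
  where
  open ≤-Reasoning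
  F G : ℕ
  F = fromBits n (f ∘ suc)
  G = fromBits n (g ∘ suc)
  tail≤ : F + 2 ^ s ≤ G
  tail≤ = fromBits-+2^-≤ n s (λ u u<s → f≗g (suc u) (s<s u<s))
            (*-cancelˡ-< 2 F G (+-cancelˡ-< (bitValue b) _ _ f<g))

odd : ℕ → Bool
odd zero          = false
odd (suc zero)    = true
odd (suc (suc n)) = odd n

odd+2*⌊/2⌋ : ∀ r → bitValue (odd r) + 2 * ⌊ r /2⌋ ≡ r
odd+2*⌊/2⌋ zero          = refl
odd+2*⌊/2⌋ (suc zero)    = refl
odd+2*⌊/2⌋ (suc (suc r)) = begin
  bitValue (odd r) + 2 * suc ⌊ r /2⌋     ≡⟨ cong (bitValue (odd r) +_) (*-suc 2 ⌊ r /2⌋) ⟩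
  bitValue (odd r) + (2 + 2 * ⌊ r /2⌋)   ≡⟨ +-comm (bitValue (odd r)) _ ⟩
  2 + 2 * ⌊ r /2⌋ + bitValue (odd r)     ≡⟨ cong (2 +_) (+-comm (2 * ⌊ r /2⌋) _) ⟩
  2 + (bitValue (odd r) + 2 * ⌊ r /2⌋)   ≡⟨ cong (2 +_) (odd+2*⌊/2⌋ r) ⟩
  2 + r                                  ∎
  where open ≡-Reasoning

toBits : ℕ → Bits
toBits r zero    = odd r
toBits r (suc u) = toBits ⌊ r /2⌋ u

fromBits-toBits : ∀ n r → r < 2 ^ n → fromBits n (toBits r) ≡ r
fromBits-toBits zero    zero    _ = refl
fromBits-toBits zero    (suc r) (s<s ())
fromBits-toBits (suc n) r r<2^1+n = begin
  bitValue (odd r) + 2 * fromBits n (toBits ⌊ r /2⌋) ≡⟨ cong (λ h → bitValue (odd r) + 2 * h) half-digits ⟩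
  bitValue (odd r) + 2 * ⌊ r /2⌋                      ≡⟨ odd+2*⌊/2⌋ r ⟩
  r                                                   ∎
  where
  open ≡-Reasoning
  2*half≤r : 2 * ⌊ r /2⌋ ≤ r
  2*half≤r = ≤-trans (m≤n+m _ (bitValue (odd r))) (≤-reflexive (odd+2*⌊/2⌋ r))
  half-digits : fromBits n (toBits ⌊ r /2⌋) ≡ ⌊ r /2⌋
  half-digits = fromBits-toBits n ⌊ r /2⌋ (*-cancelˡ-< 2 _ _ (≤-<-trans 2*half≤r r<2^1+n))

count : ∀ {k} {P : Pred (Fin k) 0ℓ} → Decidable P → ℕ
count {zero}  P? = 0
count {suc k} P? = bitValue (does (P? zero)) + count (P? ∘ suc)

count≤size : ∀ {k} {P : Pred (Fin k) 0ℓ} (P? : Decidable P) → count P? ≤ k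
count≤size {zero}  P? = z≤n
count≤size {suc k} P? = +-mono-≤ (bitValue≤1 (does (P? zero))) (count≤size (P? ∘ suc))

count-none : ∀ {k} {P : Pred (Fin k) 0ℓ} (P? : Decidable P) → (∀ i → ¬ P i) → count P? ≡ 0
count-none {zero}  P? ¬P = refl
count-none {suc k} P? ¬P with P? zero
... | yes p = contradiction p (¬P zero)
... | no _  = count-none (P? ∘ suc) (¬P ∘ suc)

bitValue-does-mono : ∀ {A B : Set} (A? : Dec A) (B? : Dec B) → (A → B) →
                     bitValue (does A?) ≤ bitValue (does B?)
bitValue-does-mono (yes a) (yes _) _   = ≤-refl
bitValue-does-mono (yes a) (no ¬b) A→B = contradiction (A→B a) ¬b
bitValue-does-mono (no _)  _       _   = z≤n

count-mono : ∀ {k} {P Q : Pred (Fin k) 0ℓ} (P? : Decidable P) (Q? : Decidable Q) →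
             P ⊆ Q → count P? ≤ count Q?
count-mono {zero}  P? Q? P⊆Q = z≤n
count-mono {suc k} P? Q? P⊆Q =
  +-mono-≤ (bitValue-does-mono (P? zero) (Q? zero) P⊆Q) (count-mono (P? ∘ suc) (Q? ∘ suc) P⊆Q)

count-mono-< : ∀ {k} {P Q : Pred (Fin k) 0ℓ} (P? : Decidable P) (Q? : Decidable Q) →
               P ⊆ Q → ∀ i → ¬ P i → Q i → count P? < count Q?
count-mono-< {suc k} P? Q? P⊆Q zero    ¬p q with P? zero | Q? zero
... | yes p | _     = contradiction p ¬p
... | no _  | no ¬q = contradiction q ¬q
... | no _  | yes _ = s≤s (count-mono (P? ∘ suc) (Q? ∘ suc) P⊆Q)
count-mono-< {suc k} P? Q? P⊆Q (suc i) ¬p q =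
  +-mono-≤-< (bitValue-does-mono (P? zero) (Q? zero) P⊆Q)
             (count-mono-< (P? ∘ suc) (Q? ∘ suc) P⊆Q i ¬p q)

count-⊆∪ : ∀ {k} {P Q R : Pred (Fin k) 0ℓ} (P? : Decidable P) (Q? : Decidable Q) (R? : Decidable R) →
           Q ⊆ P ∪ R → count Q? ≤ count P? + count R?
count-⊆∪ {zero}  P? Q? R? Q⊆P∪R = z≤n
count-⊆∪ {suc k} P? Q? R? Q⊆P∪R = begin
  q₀ + count (Q? ∘ suc)                             ≤⟨ +-mono-≤ head tail ⟩
  (p₀ + r₀) + (count (P? ∘ suc) + count (R? ∘ suc)) ≡⟨ +-interchange p₀ r₀ _ _ ⟩
  (p₀ + count (P? ∘ suc)) + (r₀ + count (R? ∘ suc)) ∎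
  where
  open ≤-Reasoning
  p₀ q₀ r₀ : ℕ
  p₀ = bitValue (does (P? zero))
  q₀ = bitValue (does (Q? zero))
  r₀ = bitValue (does (R? zero))
  tail : count (Q? ∘ suc) ≤ count (P? ∘ suc) + count (R? ∘ suc)
  tail = count-⊆∪ (P? ∘ suc) (Q? ∘ suc) (R? ∘ suc) Q⊆P∪R
  head : q₀ ≤ p₀ + r₀
  head with Q? zero | P? zero | R? zero
  ... | no _  | _     | _     = z≤n
  ... | yes _ | yes _ | _     = s≤s z≤n
  ... | yes _ | no _  | yes _ = ≤-refl
  ... | yes q | no ¬p | no ¬r = contradiction (Q⊆P∪R q) [ ¬p , ¬r ]′

count-subsingleton : ∀ {k} {P : Pred (Fin k) 0ℓ} (P? : Decidable P) →
                     (∀ {i j} → P i → P j → i ≡ j) → count P? ≤ 1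
count-subsingleton {zero}  P? unique = z≤n
count-subsingleton {suc k} P? unique with P? zero
... | yes p = ≤-reflexive (cong suc (count-none (P? ∘ suc) (λ i pᵢ → Fin.0≢1+n (unique p pᵢ))))
... | no _  = count-subsingleton (P? ∘ suc) (λ pᵢ pⱼ → Fin.suc-injective (unique pᵢ pⱼ))

module Rank {k} (K : Fin k → ℕ) (K-injective : Injective _≡_ _≡_ K) where

  below : ℕ → ℕ
  below c = count (λ l → K l <? c)

  rank : Fin k → ℕ
  rank i = below (K i)

  below-suc : ∀ c → below (suc c) ≤ suc (below c)
  below-suc c = begin
    below (suc c)                    ≤⟨ count-⊆∪ (λ l → K l <? c) (λ l → K l <? suc c) (λ l → K l ≟ c) split ⟩
    below c + count (λ l → K l ≟ c)  ≤⟨ +-monoʳ-≤ (below c) (count-subsingleton (λ l → K l ≟ c) unique) ⟩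
    below c + 1                      ≡⟨ +-comm (below c) 1 ⟩
    suc (below c)                    ∎
    where
    open ≤-Reasoning
    unique : ∀ {i j} → K i ≡ c → K j ≡ c → i ≡ j
    unique Kᵢ≡c Kⱼ≡c = K-injective (trans Kᵢ≡c (sym Kⱼ≡c))
    split : ∀ {l} → K l < suc c → K l < c ⊎ K l ≡ c
    split = m≤n⇒m<n∨m≡n ∘ s≤s⁻¹

  below-+ : ∀ n c → below (n + c) ≤ n + below c
  below-+ zero    c = ≤-refl
  below-+ (suc n) c = ≤-trans (below-suc (n + c)) (s≤s (below-+ n c))

  rank<size : ∀ i → rank i < k
  rank<size i = <-≤-trans (count-mono-< (λ l → K l <? K i) (λ l → K l <? suc (K i)) m<n⇒m<1+n i (n≮n _) ≤-refl)
                          (count≤size (λ l → K l <? suc (K i)))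

  rank-mono-< : ∀ {i j} → K i < K j → rank i < rank j
  rank-mono-< {i} {j} Kᵢ<Kⱼ =
    count-mono-< (λ l → K l <? K i) (λ l → K l <? K j) (λ Kₗ<Kᵢ → <-trans Kₗ<Kᵢ Kᵢ<Kⱼ) i (n≮n _) Kᵢ<Kⱼ

  rank-injective : Injective _≡_ _≡_ rank
  rank-injective {i} {j} eq with <-cmp (K i) (K j)
  ... | tri< Kᵢ<Kⱼ _ _ = contradiction eq (<⇒≢ (rank-mono-< Kᵢ<Kⱼ))
  ... | tri≈ _ Kᵢ≡Kⱼ _ = K-injective Kᵢ≡Kⱼ
  ... | tri> _ _ Kⱼ<Kᵢ = contradiction (sym eq) (<⇒≢ (rank-mono-< Kⱼ<Kᵢ))

  rank-gap : ∀ {i j} → K i ≤ K j → rank j ≤ (K j ∸ K i) + rank i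
  rank-gap {i} {j} Kᵢ≤Kⱼ =
    subst (λ c → below c ≤ (K j ∸ K i) + rank i) (m∸n+n≡m Kᵢ≤Kⱼ) (below-+ (K j ∸ K i) (K i))

module Relabelling {k} (m d : ℕ) (k≤2^m : k ≤ 2 ^ m) (key : Fin k → Bits)
    (key-injective : ∀ {i j} → (∀ u → u < d → key i u ≡ key j u) → i ≡ j) where

  K : Fin k → ℕ
  K i = fromBits d (key i)

  open Rank K (λ eq → key-injective (fromBits-injective d eq))

  relabel : Fin k → Bits
  relabel i = toBits (rank i)

  fromBits-relabel : ∀ i → fromBits m (relabel i) ≡ rank i
  fromBits-relabel i = fromBits-toBits m (rank i) (<-≤-trans (rank<size i) k≤2^m)

  relabel-injective : ∀ {i j} → (∀ u → u < m → relabel i u ≡ relabel j u) → i ≡ j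
  relabel-injective {i} {j} agree = rank-injective (begin
    rank i                ≡⟨ fromBits-relabel i ⟨
    fromBits m (relabel i) ≡⟨ fromBits-cong m agree ⟩
    fromBits m (relabel j) ≡⟨ fromBits-relabel j ⟩
    rank j                ∎)
    where open ≡-Reasoning

  -- The rank gap is at most the key gap, which is below 2 ^ s when the keys agree from digit s on;
  -- the new labels agree below digit s, which forces a rank gap of at least 2 ^ s.
  split-agreement⇒K≮K : ∀ s {i j} → (∀ u → u < s → relabel i u ≡ relabel j u) →
                        (∀ u → s ≤ u → u < d → key i u ≡ key j u) → ¬ K i < K j
  split-agreement⇒K≮K s {i} {j} low high Kᵢ<Kⱼ = <-irrefl refl (begin-strict
    rank j                 ≤⟨ rank-gap (<⇒≤ Kᵢ<Kⱼ) ⟩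
    (K j ∸ K i) + rank i   <⟨ +-monoˡ-< (rank i) key-gap ⟩
    2 ^ s + rank i         ≡⟨ +-comm (2 ^ s) (rank i) ⟩
    rank i + 2 ^ s         ≤⟨ label-gap ⟩
    rank j                 ∎)
    where
    open ≤-Reasoning
    key-gap : K j ∸ K i < 2 ^ s
    key-gap = m<n+o⇒m∸n<o (K j) (K i) {{m^n≢0 2 s}} (fromBits-<-+2^ d s high)
    label-gap : rank i + 2 ^ s ≤ rank j
    label-gap = subst₂ (λ x y → x + 2 ^ s ≤ y) (fromBits-relabel i) (fromBits-relabel j)
      (fromBits-+2^-≤ m s low (subst₂ _<_ (sym (fromBits-relabel i)) (sym (fromBits-relabel j))
                                          (rank-mono-< Kᵢ<Kⱼ)))

  relabel-key-injective : ∀ s {i j} → (∀ u → u < s → relabel i u ≡ relabel j u) →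
                          (∀ u → s ≤ u → u < d → key i u ≡ key j u) → i ≡ j
  relabel-key-injective s {i} {j} low high with <-cmp (K i) (K j)
  ... | tri< Kᵢ<Kⱼ _ _ = contradiction Kᵢ<Kⱼ (split-agreement⇒K≮K s low high)
  ... | tri≈ _ Kᵢ≡Kⱼ _ = key-injective (fromBits-injective d Kᵢ≡Kⱼ)
  ... | tri> _ _ Kⱼ<Kᵢ = contradiction Kⱼ<Kᵢ
    (split-agreement⇒K≮K s (λ u u<s → sym (low u u<s)) (λ u s≤u u<d → sym (high u s≤u u<d)))

module _ {V : Set} {E : V → V → Set} where

  _++ₚ_ : ∀ {x y z} → Path E x y → Path E y z → Path E x z
  [ x ]        ++ₚ q = q
  (x ∷⟨ e ⟩ p) ++ₚ q = x ∷⟨ e ⟩ (p ++ₚ q)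

  module _ {P : V → Set} where

    All-++ₚ : ∀ {x y z} (p : Path E x y) (q : Path E y z) →
              All P (nodes p) → All P (nodes q) → All P (nodes (p ++ₚ q))
    All-++ₚ [ x ]        q _          Pq = Pq
    All-++ₚ (x ∷⟨ e ⟩ p) q (Px ∷ Pp) Pq = Px ∷ All-++ₚ p q Pp Pq

    All-nodes-start : ∀ {x y} (p : Path E x y) → All P (nodes p) → P x
    All-nodes-start [ x ]        (Px ∷ _) = Px
    All-nodes-start (x ∷⟨ _ ⟩ _) (Px ∷ _) = Px

    All-nodes-forward : (∀ {x y} → E x y → P x → P y) →
                        ∀ {x y} (p : Path E x y) → P x → All P (nodes p)
    All-nodes-forward step [ x ]        Px = Px ∷ []
    All-nodes-forward step (x ∷⟨ e ⟩ p) Px = Px ∷ All-nodes-forward step p (step e Px)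

    All-nodes-backward : (∀ {x y} → E x y → P y → P x) →
                         ∀ {x y} (p : Path E x y) → P y → All P (nodes p)
    All-nodes-backward step [ x ]        Py = Py ∷ []
    All-nodes-backward step (x ∷⟨ e ⟩ p) Py = step e (All-nodes-start p Pp) ∷ Pp
      where
      Pp : All P (nodes p)
      Pp = All-nodes-backward step p Py

  chain : (Z : ℕ → V) (n : ℕ) → (∀ s → s < n → E (Z s) (Z (suc s))) → Path E (Z 0) (Z n)
  chain Z zero    _    = [ Z 0 ]
  chain Z (suc n) edge = Z 0 ∷⟨ edge 0 z<s ⟩ chain (Z ∘ suc) n (λ s s<n → edge (suc s) (s<s s<n))

  All-chain : ∀ {P : V → Set} (Z : ℕ → V) n edge →
              (∀ t → t ≤ n → P (Z t)) → All P (nodes (chain Z n edge))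
  All-chain Z zero    edge PZ = PZ 0 z≤n ∷ []
  All-chain Z (suc n) edge PZ = PZ 0 z≤n ∷ All-chain (Z ∘ suc) n _ (λ t t≤n → PZ (suc t) (s≤s t≤n))

  chainᵒᵖ : (Z : ℕ → V) (n : ℕ) → (∀ s → s < n → E (Z (suc s)) (Z s)) → Path E (Z n) (Z 0)
  chainᵒᵖ Z zero    _    = [ Z 0 ]
  chainᵒᵖ Z (suc n) edge = Z (suc n) ∷⟨ edge n ≤-refl ⟩ chainᵒᵖ Z n (λ s s<n → edge s (m<n⇒m<1+n s<n))

  All-chainᵒᵖ : ∀ {P : V → Set} (Z : ℕ → V) n edge →
                (∀ t → t ≤ n → P (Z t)) → All P (nodes (chainᵒᵖ Z n edge))
  All-chainᵒᵖ Z zero    edge PZ = PZ 0 z≤n ∷ []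
  All-chainᵒᵖ Z (suc n) edge PZ = PZ (suc n) ≤-refl ∷ All-chainᵒᵖ Z n _ (λ t t≤n → PZ t (m≤n⇒m≤1+n t≤n))

  module _ (layer : V → ℕ) (edge-layer : ∀ {x y} → E x y → layer y ≡ suc (layer x)) where

    edge-< : ∀ {x y} → E x y → layer x < layer y
    edge-< e = ≤-reflexive (sym (edge-layer e))

    nodes-unique : ∀ {x y} (p : Path E x y) → Unique (nodes p)
    nodes-unique [ x ]          = [] ∷ []
    nodes-unique (x ∷⟨ e ⟩ p) = All.map (λ x<v x≡v → <-irrefl (cong layer x≡v) x<v) after-x ∷ nodes-unique p
      where
      after-x : All (λ v → layer x < layer v) (nodes p)
      after-x = All-nodes-forward (λ e′ x<v → <-trans x<v (edge-< e′)) p (edge-< e)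

bitsOf : ∀ {n} → Vec Bool n → Bits
bitsOf []       _       = false
bitsOf (b ∷ _)  zero    = b
bitsOf (_ ∷ bs) (suc u) = bitsOf bs u

bitsOf-lookup : ∀ {n} (v : Vec Bool n) (t : Fin n) → bitsOf v (toℕ t) ≡ lookup v t
bitsOf-lookup (b ∷ _)  zero    = refl
bitsOf-lookup (_ ∷ bs) (suc t) = bitsOf-lookup bs t

bitsOf-tabulate : ∀ {n} (f : Bits) u → u < n → bitsOf (tabulate {n = n} (f ∘ toℕ)) u ≡ f u
bitsOf-tabulate {suc n} f zero    _         = refl
bitsOf-tabulate {suc n} f (suc u) (s<s u<n) = bitsOf-tabulate (f ∘ suc) u u<n

bitsOf-injective : ∀ {n} {v w : Vec Bool n} → (∀ u → u < n → bitsOf v u ≡ bitsOf w u) → v ≡ w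
bitsOf-injective {v = []}    {[]}    _     = refl
bitsOf-injective {v = _ ∷ _} {_ ∷ _} agree =
  cong₂ _∷_ (agree 0 z<s) (bitsOf-injective (λ u u<n → agree (suc u) (s<s u<n)))

BEdge-bitsOf : ∀ {d l l′ v v′} → BEdge {d} (l , v) (l′ , v′) →
               ∀ u → u < d → u ≢ toℕ l → bitsOf v u ≡ bitsOf v′ u
BEdge-bitsOf {d} {l} {l′} {v} {v′} (layer′ , keep) u u<d u≢l = begin
  bitsOf v u               ≡⟨ cong (bitsOf v) toℕ-t ⟨
  bitsOf v (toℕ t)         ≡⟨ bitsOf-lookup v t ⟩
  lookup v t               ≡⟨ keep t t≢l′ ⟩
  lookup v′ t              ≡⟨ bitsOf-lookup v′ t ⟨
  bitsOf v′ (toℕ t)        ≡⟨ cong (bitsOf v′) toℕ-t ⟩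
  bitsOf v′ u              ∎
  where
  open ≡-Reasoning
  t : Fin d
  t = fromℕ< u<d
  toℕ-t : toℕ t ≡ u
  toℕ-t = Fin.toℕ-fromℕ< u<d
  t≢l′ : suc (toℕ t) ≢ toℕ l′
  t≢l′ eq = u≢l (suc-injective (trans (cong suc (sym toℕ-t)) (trans eq layer′)))

revLabel : ∀ {n} → Vec Bool n → Vec Bool n
revLabel v = tabulate (lookup v ∘ opposite)

revLabel-involutive : ∀ {n} (v : Vec Bool n) → revLabel (revLabel v) ≡ v
revLabel-involutive v = trans (tabulate-cong lookup-twice) (tabulate∘lookup v)
  where
  lookup-twice : ∀ t → lookup (revLabel v) (opposite t) ≡ lookup v t
  lookup-twice t = trans (lookup∘tabulate (lookup v ∘ opposite) (opposite t))
                         (cong (lookup v) (Fin.opposite-involutive t))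

revNode : ∀ {d} → BNode d → BNode d
revNode (l , v) = opposite l , revLabel v

revNode-involutive : ∀ {d} (n : BNode d) → revNode (revNode n) ≡ n
revNode-involutive (l , v) = cong₂ _,_ (Fin.opposite-involutive l) (revLabel-involutive v)

BEdge-revNode : ∀ {d} {n n′ : BNode d} → BEdge n n′ → BEdge (revNode n′) (revNode n)
BEdge-revNode {d} {l , v} {l′ , v′} (layer′ , keep) = layer-rev , keep-rev
  where
  l<d : toℕ l < d
  l<d = subst (_≤ d) layer′ (Fin.toℕ≤pred[n] l′)
  layer-rev : toℕ (opposite l) ≡ suc (toℕ (opposite l′))
  layer-rev = begin
    toℕ (opposite l)          ≡⟨ Fin.opposite-prop l ⟩
    d ∸ toℕ l                 ≡⟨ +-∸-assoc 1 l<d ⟩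
    suc (d ∸ suc (toℕ l))     ≡⟨ cong (λ x → suc (d ∸ x)) layer′ ⟨
    suc (d ∸ toℕ l′)          ≡⟨ cong suc (Fin.opposite-prop l′) ⟨
    suc (toℕ (opposite l′))   ∎
    where open ≡-Reasoning
  keep-rev : ∀ t → suc (toℕ t) ≢ toℕ (opposite l) → lookup (revLabel v′) t ≡ lookup (revLabel v) t
  keep-rev t t≢l = begin
    lookup (revLabel v′) t    ≡⟨ lookup∘tabulate (lookup v′ ∘ opposite) t ⟩
    lookup v′ (opposite t)    ≡⟨ keep (opposite t) t̄≢l′ ⟨
    lookup v (opposite t)     ≡⟨ lookup∘tabulate (lookup v ∘ opposite) t ⟨
    lookup (revLabel v) t     ∎
    where
    open ≡-Reasoning
    t̄≢l′ : suc (toℕ (opposite t)) ≢ toℕ l′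
    t̄≢l′ eq = t≢l (begin
      suc (toℕ t)             ≡⟨ m∸[m∸n]≡n (Fin.toℕ<n t) ⟨
      d ∸ (d ∸ suc (toℕ t))   ≡⟨ cong (d ∸_) (Fin.opposite-prop t) ⟨
      d ∸ toℕ (opposite t)    ≡⟨ cong (d ∸_) (suc-injective (trans eq layer′)) ⟩
      d ∸ toℕ l               ≡⟨ Fin.opposite-prop l ⟨
      toℕ (opposite l)        ∎)

splice : ℕ → Bits → Bits → Bits
splice s β λ₀ u with u <? s
... | yes _ = β u
... | no  _ = λ₀ u

module _ {β λ₀ : Bits} where

  splice-< : ∀ {s u} → u < s → splice s β λ₀ u ≡ β u
  splice-< {s} {u} u<s with u <? s
  ... | yes _   = refl
  ... | no  u≮s = contradiction u<s u≮s

  splice-≥ : ∀ {s u} → s ≤ u → splice s β λ₀ u ≡ λ₀ u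
  splice-≥ {s} {u} s≤u with u <? s
  ... | yes u<s = contradiction s≤u (<⇒≱ u<s)
  ... | no  _   = refl

  splice-suc : ∀ {s u} → u ≢ s → splice s β λ₀ u ≡ splice (suc s) β λ₀ u
  splice-suc {s} {u} u≢s with <-cmp u s
  ... | tri< u<s _ _ = trans (splice-< u<s) (sym (splice-< (m<n⇒m<1+n u<s)))
  ... | tri≈ _ u≡s _ = contradiction u≡s u≢s
  ... | tri> _ _ s<u = trans (splice-≥ (<⇒≤ s<u)) (sym (splice-≥ s<u))

module Marking {d m : ℕ} (m≤d : m ≤ d) where

  spliceNode : Bits → Bits → ℕ → BNode d
  spliceNode β λ₀ s = fromℕ< (s≤s (≤-trans (m⊓n≤n s m) m≤d)) , tabulate (splice s β λ₀ ∘ toℕ)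

  layer-spliceNode : ∀ β λ₀ s → toℕ (proj₁ (spliceNode β λ₀ s)) ≡ s ⊓ m
  layer-spliceNode β λ₀ s = Fin.toℕ-fromℕ< _

  layer-spliceNode-≤ : ∀ β λ₀ {s} → s ≤ m → toℕ (proj₁ (spliceNode β λ₀ s)) ≡ s
  layer-spliceNode-≤ β λ₀ {s} s≤m = trans (layer-spliceNode β λ₀ s) (m≤n⇒m⊓n≡m s≤m)

  spliceNode-zero : ∀ β v → spliceNode β (bitsOf v) 0 ≡ (zero , v)
  spliceNode-zero β v = cong (zero ,_) (trans
    (tabulate-cong (λ t → trans (splice-≥ {β} {bitsOf v} z≤n) (bitsOf-lookup v t)))
    (tabulate∘lookup v))

  spliceNode-edge : ∀ β λ₀ {s} → s < m → BEdge (spliceNode β λ₀ s) (spliceNode β λ₀ (suc s))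
  spliceNode-edge β λ₀ {s} s<m =
    trans (layer-spliceNode-≤ β λ₀ s<m) (cong suc (sym (layer-spliceNode-≤ β λ₀ (<⇒≤ s<m)))) , keep
    where
    keep : ∀ t → suc (toℕ t) ≢ toℕ (proj₁ (spliceNode β λ₀ (suc s))) →
           lookup (tabulate (splice s β λ₀ ∘ toℕ)) t ≡ lookup (tabulate (splice (suc s) β λ₀ ∘ toℕ)) t
    keep t t≢s = begin
      lookup (tabulate (splice s β λ₀ ∘ toℕ)) t         ≡⟨ lookup∘tabulate _ t ⟩
      splice s β λ₀ (toℕ t)                             ≡⟨ splice-suc (t≢s ∘ sym ∘ suc≡) ⟩
      splice (suc s) β λ₀ (toℕ t)                       ≡⟨ lookup∘tabulate _ t ⟨
      lookup (tabulate (splice (suc s) β λ₀ ∘ toℕ)) t   ∎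
      where
      open ≡-Reasoning
      suc≡ : toℕ t ≡ s → toℕ (proj₁ (spliceNode β λ₀ (suc s))) ≡ suc (toℕ t)
      suc≡ t≡s = trans (layer-spliceNode-≤ β λ₀ s<m) (cong suc (sym t≡s))

  -- The nodes that the route with key λ₀ and new label β may pass through.
  Marked : Bits → Bits → BNode d → Set
  Marked β λ₀ (l , v) =
    (∀ u → u < toℕ l → u < m → bitsOf v u ≡ β u) ×
    (toℕ l ≤ m → ∀ u → toℕ l ≤ u → u < d → bitsOf v u ≡ λ₀ u)

  spliceNode-marked : ∀ β λ₀ {s} → s ≤ m → Marked β λ₀ (spliceNode β λ₀ s)
  spliceNode-marked β λ₀ {s} s≤m = relabelled , original
    where
    l : Fin (suc d)
    l = proj₁ (spliceNode β λ₀ s)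
    label : Vec Bool d
    label = proj₂ (spliceNode β λ₀ s)
    layer≡s : toℕ l ≡ s
    layer≡s = layer-spliceNode-≤ β λ₀ s≤m
    relabelled : ∀ u → u < toℕ l → u < m → bitsOf label u ≡ β u
    relabelled u u<s u<m =
      trans (bitsOf-tabulate _ u (<-≤-trans u<m m≤d)) (splice-< (subst (u <_) layer≡s u<s))
    original : toℕ l ≤ m → ∀ u → toℕ l ≤ u → u < d → bitsOf label u ≡ λ₀ u
    original _ u s≤u u<d = trans (bitsOf-tabulate _ u u<d) (splice-≥ (subst (_≤ u) layer≡s s≤u))

  Relabelled : Bits → Bits → BNode d → Set
  Relabelled β λ₀ n = m ≤ toℕ (proj₁ n) × Marked β λ₀ n

  spliceNode-relabelled : ∀ β λ₀ → Relabelled β λ₀ (spliceNode β λ₀ m)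
  spliceNode-relabelled β λ₀ =
    ≤-reflexive (sym (layer-spliceNode-≤ β λ₀ ≤-refl)) , spliceNode-marked β λ₀ ≤-refl

  relabelled-edge : ∀ β λ₀ {n n′} → BEdge n n′ → Relabelled β λ₀ n → Relabelled β λ₀ n′
  relabelled-edge β λ₀ {l , v} {l′ , v′} edge@(layer′ , _) (m≤l , relabelled , _) =
    ≤-trans (m≤n⇒m≤1+n m≤l) (≤-reflexive (sym layer′)) , relabelled′ , original′
    where
    relabelled′ : ∀ u → u < toℕ l′ → u < m → bitsOf v′ u ≡ β u
    relabelled′ u _ u<m = trans (sym (BEdge-bitsOf {v = v} {v′ = v′} edge u (<-≤-trans u<m m≤d) (<⇒≢ u<l)))
                                (relabelled u u<l u<m)
      where
      u<l : u < toℕ l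
      u<l = <-≤-trans u<m m≤l
    original′ : toℕ l′ ≤ m → ∀ u → toℕ l′ ≤ u → u < d → bitsOf v′ u ≡ λ₀ u
    original′ l′≤m = contradiction m≤l (<⇒≱ (subst (_≤ m) layer′ l′≤m))

  module _ {k} (k≤2^m : k ≤ 2 ^ m) (key : Fin k → Bits)
           (key-injective : ∀ {i j} → (∀ u → u < d → key i u ≡ key j u) → i ≡ j) where

    open Relabelling m d k≤2^m key key-injective using (relabel; relabel-injective; relabel-key-injective)

    marked-unique : ∀ {i j n} → Marked (relabel i) (key i) n → Marked (relabel j) (key j) n → i ≡ j
    marked-unique {i} {j} {l , v} (relabelledᵢ , originalᵢ) (relabelledⱼ , originalⱼ) =
      by-layer (m ≤? toℕ l)
      where
      same-relabel : ∀ u → u < toℕ l → u < m → relabel i u ≡ relabel j u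
      same-relabel u u<l u<m = trans (sym (relabelledᵢ u u<l u<m)) (relabelledⱼ u u<l u<m)
      same-key : toℕ l ≤ m → ∀ u → toℕ l ≤ u → u < d → key i u ≡ key j u
      same-key l≤m u l≤u u<d = trans (sym (originalᵢ l≤m u l≤u u<d)) (originalⱼ l≤m u l≤u u<d)
      by-layer : Dec (m ≤ toℕ l) → i ≡ j
      by-layer (yes m≤l) = relabel-injective (λ u u<m → same-relabel u (<-≤-trans u<m m≤l) u<m)
      by-layer (no  m≰l) = relabel-key-injective (toℕ l)
        (λ u u<l → same-relabel u u<l (<-trans u<l (≰⇒> m≰l))) (same-key (<⇒≤ (≰⇒> m≰l)))

module ButterflyLikeProperties {d} (B : ButterflyLike d) where
  open ButterflyLike B
  open Inverse iso public using (to; from; strictlyInverseˡ; strictlyInverseʳ)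

  BEdge-to : ∀ {x y} → Edge x y → BEdge (to x) (to y)
  BEdge-to = Equivalence.to (edge-iso _ _)

  Edge-from : ∀ {n n′} → BEdge n n′ → Edge (from n) (from n′)
  Edge-from {n} {n′} e =
    Equivalence.from (edge-iso _ _) (subst₂ BEdge (sym (strictlyInverseˡ n)) (sym (strictlyInverseˡ n′)) e)

  layer-from : ∀ n → layer (from n) ≡ toℕ (proj₁ n)
  layer-from n = cong (toℕ ∘ proj₁) (strictlyInverseˡ n)

module ButterflyPairProperties {d} (G : ButterflyPair d) where
  open ButterflyPair G
  module P₁ = ButterflyLikeProperties G₁
  module P₂ = ButterflyLikeProperties G₂

  node₁ : BNode d → PNode
  node₁ n = inj₁ (P₁.from n)

  node₂ : (n : BNode d) → 1 ≤ toℕ (proj₁ n) → PNode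
  node₂ n 1≤l = inj₂ (P₂.from n , subst (1 ≤_) (sym (P₂.layer-from n)) 1≤l)

  ≡-node₂ : ∀ {w q n p} → w ≡ P₂.from n → inj₂ (w , q) ≡ node₂ n p
  ≡-node₂ refl = cong (λ q → inj₂ (_ , q)) (≤-irrelevant _ _)

  layer-node₁ : ∀ n → layer (node₁ n) ≡ toℕ (proj₁ n)
  layer-node₁ = P₁.layer-from

  layer-node₂ : ∀ n p → layer (node₂ n p) ≡ d + toℕ (proj₁ n)
  layer-node₂ n p = cong (d +_) (P₂.layer-from n)

  PEdge-node₁ : ∀ {n n′} → BEdge n n′ → PEdge (node₁ n) (node₁ n′)
  PEdge-node₁ = P₁.Edge-from

  PEdge-node₂ : ∀ {n n′ p p′} → BEdge n n′ → PEdge (node₂ n p) (node₂ n′ p′)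
  PEdge-node₂ = P₂.Edge-from

  PEdge-layer : ∀ {x y} → PEdge x y → layer y ≡ suc (layer x)
  PEdge-layer {inj₁ x} {inj₁ y}       e         = proj₁ (P₁.BEdge-to e)
  PEdge-layer {inj₁ x} {inj₂ (w , _)} (x-out , e) = begin
    d + B₂.layer w                 ≡⟨ cong (d +_) (proj₁ (P₂.BEdge-to e)) ⟩
    d + suc (B₂.layer (proj₁ x′))  ≡⟨ cong (λ l → d + suc l) (proj₂ x′) ⟩
    d + 1                          ≡⟨ +-comm d 1 ⟩
    suc d                          ≡⟨ cong suc x-out ⟨
    suc (B₁.layer x)               ∎
    where
    open ≡-Reasoning
    x′ : B₂.Inputs
    x′ = Inverse.to glue (x , x-out)
  PEdge-layer {inj₂ (w , _)} {inj₂ (w′ , _)} e = trans (cong (d +_) (proj₁ (P₂.BEdge-to e))) (+-suc d _)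

  PEdge-nodes-unique : ∀ {x y} (p : Path PEdge x y) → Unique (nodes p)
  PEdge-nodes-unique = nodes-unique layer (λ {x} {y} → PEdge-layer {x} {y})

  input-label : ∀ z → layer z ≡ 0 → Σ (Vec Bool d) (λ v → z ≡ node₁ (zero , v))
  input-label (inj₁ x) layer≡0 = proj₂ (P₁.to x) , (begin
    inj₁ x                         ≡⟨ cong inj₁ (P₁.strictlyInverseʳ x) ⟨
    inj₁ (P₁.from (P₁.to x))       ≡⟨ cong (λ l → node₁ (l , proj₂ (P₁.to x))) (Fin.toℕ-injective layer≡0) ⟩
    node₁ (zero , proj₂ (P₁.to x)) ∎)
    where open ≡-Reasoning
  input-label (inj₂ (w , 1≤l)) layer≡0 = contradiction (m+n≡0⇒n≡0 d layer≡0) (>⇒≢ 1≤l)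

  output-label : 0 < d → ∀ z → layer z ≡ d + d → Σ (Vec Bool d) (λ v → ∀ p → z ≡ node₂ (fromℕ d , v) p)
  output-label 0<d (inj₁ x)       layer≡2d =
    contradiction (subst (_≤ d) layer≡2d (Fin.toℕ≤pred[n] (proj₁ (P₁.to x)))) (<⇒≱ (m<m+n d 0<d))
  output-label 0<d (inj₂ (w , _)) layer≡2d = proj₂ (P₂.to w) , λ p → ≡-node₂ (begin
    w                                   ≡⟨ P₂.strictlyInverseʳ w ⟨
    P₂.from (P₂.to w)                   ≡⟨ cong (λ l → P₂.from (l , proj₂ (P₂.to w))) layer≡fromℕ ⟩
    P₂.from (fromℕ d , proj₂ (P₂.to w)) ∎)
    where
    open ≡-Reasoning
    layer≡fromℕ : proj₁ (P₂.to w) ≡ fromℕ d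
    layer≡fromℕ = Fin.toℕ-injective (trans (+-cancelˡ-≡ d _ _ layer≡2d) (sym (Fin.toℕ-fromℕ d)))

module Routing {d m : ℕ} (G : ButterflyPair d) (m<d : m < d) where
  open ButterflyPair G
  open ButterflyPairProperties G
  open Marking (<⇒≤ m<d)

  0<d : 0 < d
  0<d = ≤-<-trans z≤n m<d

  1≤toℕ-fromℕ : 1 ≤ toℕ (fromℕ d)
  1≤toℕ-fromℕ = subst (1 ≤_) (sym (Fin.toℕ-fromℕ d)) 0<d

  node₂-cong : ∀ {n n′ p p′} → n ≡ n′ → node₂ n p ≡ node₂ n′ p′
  node₂-cong eq = ≡-node₂ (cong P₂.from eq)

  revNode-to-from : ∀ n → revNode (P₂.to (P₂.from (revNode n))) ≡ n
  revNode-to-from n = trans (cong revNode (P₂.strictlyInverseˡ (revNode n))) (revNode-involutive n)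

  module _ (middle : ∀ u v → layer u ≡ m → layer v ≡ (d + d) ∸ m → Path PEdge u v)
           {k} (k≤2^m : k ≤ 2 ^ m) (a b : Fin k → PNode)
           (a-injective : Injective _≡_ _≡_ a) (b-injective : Injective _≡_ _≡_ b)
           (a-input : ∀ i → layer (a i) ≡ 0) (b-output : ∀ i → layer (b i) ≡ d + d) where

    inLabel outLabel : Fin k → Vec Bool d
    inLabel  i = proj₁ (input-label (a i) (a-input i))
    outLabel i = proj₁ (output-label 0<d (b i) (b-output i))

    -- G₂ is routed in reversed coordinates, so its key reads the output label backwards.
    key₁ key₂ : Fin k → Bits
    key₁ i = bitsOf (inLabel i)
    key₂ i = bitsOf (revLabel (outLabel i))

    a-node : ∀ i → a i ≡ node₁ (zero , inLabel i)
    a-node i = proj₂ (input-label (a i) (a-input i))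

    b-node : ∀ i → b i ≡ node₂ (fromℕ d , outLabel i) 1≤toℕ-fromℕ
    b-node i = proj₂ (output-label 0<d (b i) (b-output i)) 1≤toℕ-fromℕ

    key₁-injective : ∀ {i j} → (∀ u → u < d → key₁ i u ≡ key₁ j u) → i ≡ j
    key₁-injective {i} {j} agree = a-injective (begin
      a i                        ≡⟨ a-node i ⟩
      node₁ (zero , inLabel i)   ≡⟨ cong (λ v → node₁ (zero , v)) (bitsOf-injective agree) ⟩
      node₁ (zero , inLabel j)   ≡⟨ a-node j ⟨
      a j                        ∎)
      where open ≡-Reasoning

    key₂-injective : ∀ {i j} → (∀ u → u < d → key₂ i u ≡ key₂ j u) → i ≡ j
    key₂-injective {i} {j} agree = b-injective (begin
      b i                                        ≡⟨ b-node i ⟩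
      node₂ (fromℕ d , outLabel i) 1≤toℕ-fromℕ   ≡⟨ node₂-cong (cong (fromℕ d ,_) labels≡) ⟩
      node₂ (fromℕ d , outLabel j) 1≤toℕ-fromℕ   ≡⟨ b-node j ⟨
      b j                                        ∎)
      where
      open ≡-Reasoning
      revLabels≡ : revLabel (outLabel i) ≡ revLabel (outLabel j)
      revLabels≡ = bitsOf-injective agree
      labels≡ : outLabel i ≡ outLabel j
      labels≡ = begin
        outLabel i                       ≡⟨ revLabel-involutive (outLabel i) ⟨
        revLabel (revLabel (outLabel i)) ≡⟨ cong revLabel revLabels≡ ⟩
        revLabel (revLabel (outLabel j)) ≡⟨ revLabel-involutive (outLabel j) ⟩
        outLabel j                       ∎

    new₁ new₂ : Fin k → Bits
    new₁ = Relabelling.relabel m d k≤2^m key₁ key₁-injective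
    new₂ = Relabelling.relabel m d k≤2^m key₂ key₂-injective

    Marked₁ Marked₂ : Fin k → BNode d → Set
    Marked₁ i = Marked (new₁ i) (key₁ i)
    Marked₂ i = Marked (new₂ i) (key₂ i)

    Mark : Fin k → PNode → Set
    Mark i (inj₁ x)       = Marked₁ i (P₁.to x)
    Mark i (inj₂ (w , _)) = Marked₂ i (revNode (P₂.to w))

    Mark-unique : ∀ {i j} v → Mark i v → Mark j v → i ≡ j
    Mark-unique (inj₁ x)       = marked-unique k≤2^m key₁ key₁-injective {n = P₁.to x}
    Mark-unique (inj₂ (w , _)) = marked-unique k≤2^m key₂ key₂-injective {n = revNode (P₂.to w)}

    Mark-node₁ : ∀ {i n} → Marked₁ i n → Mark i (node₁ n)
    Mark-node₁ {i} {n} = subst (Marked₁ i) (sym (P₁.strictlyInverseˡ n))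

    Mark-node₂ : ∀ {i n p} → Marked₂ i n → Mark i (node₂ (revNode n) p)
    Mark-node₂ {i} {n} = subst (Marked₂ i) (sym (revNode-to-from n))

    pre post : Fin k → ℕ → BNode d
    pre i = spliceNode (new₁ i) (key₁ i)
    post i = spliceNode (new₂ i) (key₂ i)

    layer-pre-≤ : ∀ i {s} → s ≤ m → toℕ (proj₁ (pre i s)) ≡ s
    layer-pre-≤ i = layer-spliceNode-≤ (new₁ i) (key₁ i)

    layer-post-≤ : ∀ i {s} → s ≤ m → toℕ (proj₁ (post i s)) ≡ s
    layer-post-≤ i = layer-spliceNode-≤ (new₂ i) (key₂ i)

    1≤layer-revNode-post : ∀ i s → 1 ≤ toℕ (proj₁ (revNode (post i s)))
    1≤layer-revNode-post i s = begin
      1                               ≤⟨ m<n⇒0<n∸m m<d ⟩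
      d ∸ m                           ≤⟨ ∸-monoʳ-≤ d (m⊓n≤n s m) ⟩
      d ∸ (s ⊓ m)                     ≡⟨ cong (d ∸_) (layer-spliceNode (new₂ i) (key₂ i) s) ⟨
      d ∸ toℕ (proj₁ (post i s))      ≡⟨ Fin.opposite-prop (proj₁ (post i s)) ⟨
      toℕ (proj₁ (revNode (post i s))) ∎
      where open ≤-Reasoning

    preNode postNode : Fin k → ℕ → PNode
    preNode i s = node₁ (pre i s)
    postNode i s = node₂ (revNode (post i s)) (1≤layer-revNode-post i s)

    preNode-edge : ∀ i {s} → s < m → PEdge (preNode i s) (preNode i (suc s))
    preNode-edge i s<m = PEdge-node₁ (spliceNode-edge (new₁ i) (key₁ i) s<m)

    postNode-edge : ∀ i {s} → s < m → PEdge (postNode i (suc s)) (postNode i s)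
    postNode-edge i {s} s<m =
      PEdge-node₂ {p = 1≤layer-revNode-post i (suc s)} {p′ = 1≤layer-revNode-post i s}
                  (BEdge-revNode {n = post i s} {post i (suc s)} (spliceNode-edge (new₂ i) (key₂ i) s<m))

    prefix : ∀ i → Path PEdge (preNode i 0) (preNode i m)
    prefix i = chain (preNode i) m (λ _ → preNode-edge i)

    suffix : ∀ i → Path PEdge (postNode i m) (postNode i 0)
    suffix i = chainᵒᵖ (postNode i) m (λ _ → postNode-edge i)

    layer-preNode-m : ∀ i → layer (preNode i m) ≡ m
    layer-preNode-m i = trans (layer-node₁ (pre i m)) (layer-pre-≤ i ≤-refl)

    layer-postNode-m : ∀ i → layer (postNode i m) ≡ (d + d) ∸ m
    layer-postNode-m i = begin
      layer (postNode i m)                   ≡⟨ layer-node₂ (revNode (post i m)) (1≤layer-revNode-post i m) ⟩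
      d + toℕ (opposite (proj₁ (post i m)))  ≡⟨ cong (d +_) (Fin.opposite-prop (proj₁ (post i m))) ⟩
      d + (d ∸ toℕ (proj₁ (post i m)))       ≡⟨ cong (λ l → d + (d ∸ l)) (layer-post-≤ i ≤-refl) ⟩
      d + (d ∸ m)                            ≡⟨ +-∸-assoc d (<⇒≤ m<d) ⟨
      (d + d) ∸ m                            ∎
      where open ≡-Reasoning

    crossing : ∀ i → Path PEdge (preNode i m) (postNode i m)
    crossing i = middle _ _ (layer-preNode-m i) (layer-postNode-m i)

    route : ∀ i → Path PEdge (preNode i 0) (postNode i 0)
    route i = prefix i ++ₚ (crossing i ++ₚ suffix i)

    Relabelled₁ Relabelled₂ : Fin k → BNode d → Set
    Relabelled₁ i = Relabelled (new₁ i) (key₁ i)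
    Relabelled₂ i = Relabelled (new₂ i) (key₂ i)

    -- The crossing path is relabelled forwards from its start in G₁ and backwards from its end in G₂.
    Forward Backward : Fin k → PNode → Set
    Forward i (inj₁ x)        = Relabelled₁ i (P₁.to x)
    Forward i (inj₂ _)        = ⊤
    Backward i (inj₁ _)       = ⊤
    Backward i (inj₂ (w , _)) = Relabelled₂ i (revNode (P₂.to w))

    Forward-edge : ∀ i {x y} → PEdge x y → Forward i x → Forward i y
    Forward-edge i {inj₁ x} {inj₁ y} e =
      relabelled-edge (new₁ i) (key₁ i) {P₁.to x} {P₁.to y} (P₁.BEdge-to e)
    Forward-edge i {inj₁ _} {inj₂ _} _ = λ _ → tt
    Forward-edge i {inj₂ _} {inj₂ _} _ = λ _ → tt

    Backward-edge : ∀ i {x y} → PEdge x y → Backward i y → Backward i x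
    Backward-edge i {inj₁ _} {_}      _ = λ _ → tt
    Backward-edge i {inj₂ (w , _)} {inj₂ (w′ , _)} e =
      relabelled-edge (new₂ i) (key₂ i) {revNode (P₂.to w′)} {revNode (P₂.to w)}
                      (BEdge-revNode {n = P₂.to w} {P₂.to w′} (P₂.BEdge-to e))

    Forward-Backward⇒Mark : ∀ i v → Forward i v → Backward i v → Mark i v
    Forward-Backward⇒Mark i (inj₁ _) (_ , mark) _        = mark
    Forward-Backward⇒Mark i (inj₂ _) _        (_ , mark) = mark

    crossing-marked : ∀ i → All (Mark i) (nodes (crossing i))
    crossing-marked i = All.zipWith (λ {v} (f , b) → Forward-Backward⇒Mark i v f b)
      (All-nodes-forward (Forward-edge i) (crossing i) start , All-nodes-backward (Backward-edge i) (crossing i) end)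
      where
      start : Forward i (preNode i m)
      start = subst (Relabelled₁ i) (sym (P₁.strictlyInverseˡ (pre i m))) (spliceNode-relabelled (new₁ i) (key₁ i))
      end : Backward i (postNode i m)
      end = subst (Relabelled₂ i) (sym (revNode-to-from (post i m))) (spliceNode-relabelled (new₂ i) (key₂ i))

    route-marked : ∀ i → All (Mark i) (nodes (route i))
    route-marked i =
      All-++ₚ (prefix i) _ prefix-marked (All-++ₚ (crossing i) (suffix i) (crossing-marked i) suffix-marked)
      where
      prefix-marked : All (Mark i) (nodes (prefix i))
      prefix-marked = All-chain (preNode i) m _ (λ t t≤m → Mark-node₁ (spliceNode-marked (new₁ i) (key₁ i) t≤m))
      suffix-marked : All (Mark i) (nodes (suffix i))
      suffix-marked = All-chainᵒᵖ (postNode i) m _ (λ t t≤m →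
        Mark-node₂ {n = post i t} {p = 1≤layer-revNode-post i t} (spliceNode-marked (new₂ i) (key₂ i) t≤m))

    preNode-0 : ∀ i → preNode i 0 ≡ a i
    preNode-0 i = trans (cong node₁ (spliceNode-zero (new₁ i) (inLabel i))) (sym (a-node i))

    postNode-0 : ∀ i → postNode i 0 ≡ b i
    postNode-0 i = trans (node₂-cong revNode-post-0) (sym (b-node i))
      where
      revNode-post-0 : revNode (post i 0) ≡ (fromℕ d , outLabel i)
      revNode-post-0 = trans (cong revNode (spliceNode-zero (new₂ i) (revLabel (outLabel i))))
                             (cong (fromℕ d ,_) (revLabel-involutive (outLabel i)))

    routes : ∀ i → Σ (Path PEdge (a i) (b i)) (λ p → All (Mark i) (nodes p))
    routes i = subst₂ (λ x y → Σ (Path PEdge x y) (λ p → All (Mark i) (nodes p)))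
                      (preNode-0 i) (postNode-0 i) (route i , route-marked i)

    disjoint-routes : Σ ((i : Fin k) → Path PEdge (a i) (b i)) (λ P →
                        ((i : Fin k) → Unique (nodes (P i))) ×
                        ((i j : Fin k) → i ≢ j → Disjoint (nodes (P i)) (nodes (P j))))
    disjoint-routes =
      (λ i → proj₁ (routes i)) ,
      (λ i → PEdge-nodes-unique (proj₁ (routes i))) ,
      (λ i j i≢j (v∈Pᵢ , v∈Pⱼ) →
        i≢j (Mark-unique _ (All.lookup (proj₂ (routes i)) v∈Pᵢ) (All.lookup (proj₂ (routes j)) v∈Pⱼ)))

Fin≤1-unique : ∀ {k} → k ≤ 1 → (i j : Fin k) → i ≡ j
Fin≤1-unique (s≤s z≤n) zero zero = refl

corollary2 : (d : ℕ) (G : ButterflyPair d) →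
    let open ButterflyPair G in
    ((u v : PNode) → layer u ≡ ⌊ d /2⌋ → layer v ≡ (d + d) ∸ ⌊ d /2⌋ → Path PEdge u v) →
    (k : ℕ) → k ≤ 2 ^ ⌊ d /2⌋ →
    (a b : Fin k → PNode) →
    Injective _≡_ _≡_ a → Injective _≡_ _≡_ b →
    ((i : Fin k) → layer (a i) ≡ 0) → ((i : Fin k) → layer (b i) ≡ d + d) →
    Σ ((i : Fin k) → Path PEdge (a i) (b i)) (λ P →
      ((i : Fin k) → Unique (nodes (P i))) ×
      ((i j : Fin k) → i ≢ j → Disjoint (nodes (P i)) (nodes (P j))))
corollary2 zero G middle k k≤1 a b _ _ a-input b-output =
  P , (λ i → PEdge-nodes-unique (P i)) , (λ i j i≢j _ → i≢j (Fin≤1-unique k≤1 i j))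
  where
  open ButterflyPair G
  open ButterflyPairProperties G
  P : ∀ i → Path PEdge (a i) (b i)
  P i = middle (a i) (b i) (a-input i) (b-output i)
corollary2 d@(suc d′) G middle k k≤2^m a b a-injective b-injective a-input b-output =
  Routing.disjoint-routes G (⌊n/2⌋<n d′) middle k≤2^m a b a-injective b-injective a-input b-output
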